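{- Let $\Lambda$ be a numerical semigroup of genus $g$. Then its square diagram $\tau(\Lambda)$ is a Dyck path (of order $g$): it goes from $(0,0)$ to $(g,g)$ and every lattice point $(x,y)$ on it satisfies $y\geq x$.
   Context: A numerical semigroup is a subset $\Lambda\subseteq\mathbb{N}_0$ containing $0$, closed under addition, with finite complement in $\mathbb{N}_0$; elements of $\mathbb{N}_0\setminus\Lambda$ are gaps and their number is the genus $g$. The square diagram $\tau(\Lambda)$ is the lattice path starting at $(0,0)$ with steps $e(i)$, $1\le i\le 2g$, where $e(i)=(1,0)$ (right-step) if $i\in\Lambda$ and $e(i)=(0,1)$ (up-step) if $i\notin\Lambda$. A Dyck path of order $n$ is a lattice path from $(0,0)$ to $(n,n)$ consisting of up-steps $(0,1)$ and right-steps $(1,0)$ that never goes below the diagonal $x=y$. -}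

module Defs where

open import Data.Nat using (ℕ; zero; suc; _+_; _≤_)
open import Data.List using (List; []; _∷_; length; map; upTo; take)
open import Data.List.Membership.Propositional using (_∈_)
open import Data.List.Relation.Unary.Unique.Propositional using (Unique)
open import Data.Product using (_×_; _,_; proj₁; proj₂)
open import Relation.Nullary using (¬_; Dec; yes; no)
open import Relation.Unary using (Pred; Decidable)
open import Function.Bundles using (_⇔_)
open import Level using (0ℓ)

record NumericalSemigroup : Set₁ where
  field
    Λ       : Pred ℕ 0ℓ
    Λ?      : Decidable Λ
    zero∈   : Λ 0
    closed  : ∀ {a b} → Λ a → Λ b → Λ (a + b)
    gaps    : List ℕ
    gaps-unique : Unique gaps
    gaps-spec   : ∀ n → (n ∈ gaps) ⇔ (¬ Λ n)

  genus : ℕ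
  genus = length gaps

open NumericalSemigroup public

Point : Set
Point = ℕ × ℕ

data Step : Set where
  right up : Step

move : Point → Step → Point
move (x , y) right = (suc x , y)
move (x , y) up    = (x , suc y)

e : (S : NumericalSemigroup) → ℕ → Step
e S i with Λ? S i
... | yes _ = right
... | no  _ = up

oneTo : ℕ → List ℕ
oneTo n = map suc (upTo n)

τ : NumericalSemigroup → List Step
τ S = map (e S) (oneTo (genus S + genus S))

points : Point → List Step → List Point
points p []       = p ∷ []
points p (s ∷ ss) = p ∷ points (move p s) ss

endpoint : Point → List Step → Point
endpoint p []       = p
endpoint p (s ∷ ss) = endpoint (move p s) ss

IsDyckPath : ℕ → List Step → Set
IsDyckPath n path =
  endpoint (0 , 0) path ≡ (n , n) ×
  (∀ {x y} → (x , y) ∈ points (0 , 0) path → x ≤ y)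
  where open import Relation.Binary.PropositionalEquality using (_≡_)

-- After n steps τ(Λ) stands at (#nongaps in [1, n], #gaps in [1, n]). If h is the first gap
-- above m, then s ↦ h − s maps the nongaps in [1, m] injectively to gaps in [1, m], so the path
-- is weakly above the diagonal after m steps. Taking m = h − 1 for a gap h shows h ≤ 2g, so after
-- 2g steps all g gaps are counted and the path ends at (g, g); if no gap exceeds m ≤ 2g, the
-- point is (m − g, g), again above the diagonal.
module Submission where

open import Defs
open import Data.Nat
open import Data.Nat.Properties
open import Data.List using (List; []; _∷_; length; map; filter; upTo; applyUpTo; _++_)
open import Data.List.Properties using (length-map; length-++; length-upTo; map-upTo; map-applyUpTo)
open import Data.List.Membership.Propositional using (_∈_; find)
open import Data.List.Membership.Propositional.Properties
  using (∈-map⁺; ∈-map⁻; ∈-upTo⁺; ∈-upTo⁻; ∈-filter⁺; ∈-filter⁻; ∈-∃++; ∈-++⁻; ∈-++⁺ˡ; ∈-++⁺ʳ)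
open import Data.List.Relation.Binary.Subset.Propositional using (_⊆_)
open import Data.List.Relation.Unary.All as All using (All)
open import Data.List.Relation.Unary.All.Properties using (¬Any⇒All¬; map⁺)
open import Data.List.Relation.Unary.Any using (here; there; any?)
open import Data.List.Relation.Unary.AllPairs using ([]; _∷_)
open import Data.List.Relation.Unary.Unique.Propositional using (Unique)
import Data.List.Relation.Unary.Unique.Propositional.Properties as Unique
open import Data.Product using (∃-syntax; _×_; _,_; proj₁; proj₂; map₁)
open import Data.Sum using (inj₁; inj₂)
open import Function.Base using (_∘_)
open import Function.Bundles using (Equivalence)
open import Relation.Nullary using (¬_; yes; no; contradiction)
open import Relation.Unary using (Pred; Decidable)
open import Relation.Unary.Properties using (∁?)
open import Relation.Binary.PropositionalEquality

module _ {a p} {A : Set a} {P : Pred A p} (P? : Decidable P) where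

  length-filter+length-filter-∁ : ∀ xs →
    length (filter P? xs) + length (filter (∁? P?) xs) ≡ length xs
  length-filter+length-filter-∁ []       = refl
  length-filter+length-filter-∁ (x ∷ xs) with P? x
  ... | yes _ = cong suc (length-filter+length-filter-∁ xs)
  ... | no  _ = trans (+-suc _ _) (cong suc (length-filter+length-filter-∁ xs))

module _ {a} {A : Set a} where

  Unique-⊆⇒length-≤ : {xs ys : List A} → Unique xs → xs ⊆ ys → length xs ≤ length ys
  Unique-⊆⇒length-≤ {[]}     _            _     = z≤n
  Unique-⊆⇒length-≤ {x ∷ xs} (x∉xs ∷ !xs) xs⊆ys
    with as , bs , refl ← ∈-∃++ (xs⊆ys (here refl)) = begin
      suc (length xs)             ≤⟨ s≤s (Unique-⊆⇒length-≤ !xs xs⊆as++bs) ⟩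
      suc (length (as ++ bs))     ≡⟨ cong suc (length-++ as) ⟩
      suc (length as + length bs) ≡⟨ +-suc (length as) (length bs) ⟨
      length as + length (x ∷ bs) ≡⟨ length-++ as ⟨
      length (as ++ x ∷ bs)       ∎
    where
    open ≤-Reasoning
    xs⊆as++bs : xs ⊆ as ++ bs
    xs⊆as++bs {z} z∈xs with ∈-++⁻ as (xs⊆ys (there z∈xs))
    ... | inj₁ z∈as         = ∈-++⁺ˡ z∈as
    ... | inj₂ (here refl)  = contradiction refl (All.lookup x∉xs z∈xs)
    ... | inj₂ (there z∈bs) = ∈-++⁺ʳ as z∈bs

module _ {a b} {A : Set a} {B : Set b} {f : A → B} where

  Unique-map⁺-injectiveOn : {xs : List A} → (∀ {x y} → x ∈ xs → y ∈ xs → f x ≡ f y → x ≡ y) →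
                            Unique xs → Unique (map f xs)
  Unique-map⁺-injectiveOn {[]}     _   []           = []
  Unique-map⁺-injectiveOn {x ∷ xs} inj (x∉xs ∷ !xs) =
    map⁺ (All.tabulate λ y∈xs fx≡fy → All.lookup x∉xs y∈xs (inj (here refl) (there y∈xs) fx≡fy))
    ∷ Unique-map⁺-injectiveOn (λ x∈ y∈ → inj (there x∈) (there y∈)) !xs

module _ {p} {Q : Pred ℕ p} (Q? : Decidable Q) where

  firstFailureAbove : ∀ {m h} → ¬ Q h → m < h →
                      ∃[ k ] ¬ Q k × m < k × (∀ {j} → m < j → j < k → Q j)
  firstFailureAbove {m} {h} ¬Qh m<h =
    scan (h ∸ suc m) (suc m) ≤-refl
         (λ m<j j<1+m → contradiction (≤-pred j<1+m) (<⇒≱ m<j))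
         (subst (¬_ ∘ Q) (sym (m∸n+n≡m m<h)) ¬Qh)
    where
    scan : ∀ d k → m < k → (∀ {j} → m < j → j < k → Q j) → ¬ Q (d + k) →
           ∃[ k ] ¬ Q k × m < k × (∀ {j} → m < j → j < k → Q j)
    scan d k m<k Q-between ¬Qd+k with Q? k
    ... | no ¬Qk = k , ¬Qk , m<k , Q-between
    scan zero    k m<k Q-between ¬Qk   | yes Qk = contradiction Qk ¬Qk
    scan (suc d) k m<k Q-between ¬Qd+k | yes Qk =
      scan d (suc k) (m<n⇒m<1+n m<k) Q-between′ (subst (¬_ ∘ Q) (sym (+-suc d k)) ¬Qd+k)
      where
      Q-between′ : ∀ {j} → m < j → j < suc k → Q j
      Q-between′ m<j j<1+k with m≤n⇒m<n∨m≡n (≤-pred j<1+k)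
      ... | inj₁ j<k  = Q-between m<j j<k
      ... | inj₂ refl = Qk

∈-points⇒endpoint-prefix : ∀ (f : ℕ → Step) n {p q} → q ∈ points p (applyUpTo f n) →
                            ∃[ j ] j ≤ n × q ≡ endpoint p (applyUpTo f j)
∈-points⇒endpoint-prefix f zero    (here q≡p) = 0 , z≤n , q≡p
∈-points⇒endpoint-prefix f (suc n) (here q≡p) = 0 , z≤n , q≡p
∈-points⇒endpoint-prefix f (suc n) (there q∈)
  with j , j≤n , q≡ ← ∈-points⇒endpoint-prefix (f ∘ suc) n q∈ = suc j , s≤s j≤n , q≡

∈-oneTo⁺ : ∀ {k n} → 0 < k → k ≤ n → k ∈ oneTo n
∈-oneTo⁺ {suc k} _ k<n = ∈-map⁺ suc (∈-upTo⁺ k<n)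

∈-oneTo⁻ : ∀ {k n} → k ∈ oneTo n → 0 < k × k ≤ n
∈-oneTo⁻ k∈ with i , i∈ , refl ← ∈-map⁻ suc k∈ = z<s , ∈-upTo⁻ i∈

oneTo-unique : ∀ n → Unique (oneTo n)
oneTo-unique n = Unique.map⁺ suc-injective (Unique.upTo⁺ n)

length-oneTo : ∀ n → length (oneTo n) ≡ n
length-oneTo n = trans (length-map suc (upTo n)) (length-upTo n)

map-oneTo : ∀ {a} {A : Set a} (f : ℕ → A) n → map f (oneTo n) ≡ applyUpTo (f ∘ suc) n
map-oneTo f n = trans (cong (map f) (map-upTo suc n)) (map-applyUpTo suc f n)

module _ (S : NumericalSemigroup) where

  private
    g : ℕ
    g = genus S

  nongapsUpTo gapsUpTo : ℕ → List ℕ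
  nongapsUpTo n = filter (Λ? S) (oneTo n)
  gapsUpTo    n = filter (∁? (Λ? S)) (oneTo n)

  endpoint-map-e : ∀ a b xs → endpoint (a , b) (map (e S) xs) ≡
                   (a + length (filter (Λ? S) xs) , b + length (filter (∁? (Λ? S)) xs))
  endpoint-map-e a b []       = cong₂ _,_ (sym (+-identityʳ a)) (sym (+-identityʳ b))
  endpoint-map-e a b (k ∷ ks) with Λ? S k
  ... | yes _ = trans (endpoint-map-e (suc a) b ks) (cong (_, b + #gaps) (sym (+-suc a #nongaps)))
    where #nongaps = length (filter (Λ? S) ks); #gaps = length (filter (∁? (Λ? S)) ks)
  ... | no  _ = trans (endpoint-map-e a (suc b) ks) (cong (a + #nongaps ,_) (sym (+-suc b #gaps)))
    where #nongaps = length (filter (Λ? S) ks); #gaps = length (filter (∁? (Λ? S)) ks)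

  endpoint-prefix : ∀ n → endpoint (0 , 0) (applyUpTo (e S ∘ suc) n) ≡
                    (length (nongapsUpTo n) , length (gapsUpTo n))
  endpoint-prefix n = trans (cong (endpoint (0 , 0)) (sym (map-oneTo (e S) n)))
                            (endpoint-map-e 0 0 (oneTo n))

  length-nongapsUpTo+length-gapsUpTo : ∀ n → length (nongapsUpTo n) + length (gapsUpTo n) ≡ n
  length-nongapsUpTo+length-gapsUpTo n =
    trans (length-filter+length-filter-∁ (Λ? S) (oneTo n)) (length-oneTo n)

  gap⇒¬Λ : ∀ {h} → h ∈ gaps S → ¬ Λ S h
  gap⇒¬Λ {h} = Equivalence.to (gaps-spec S h)

  ¬Λ⇒gap : ∀ {h} → ¬ Λ S h → h ∈ gaps S
  ¬Λ⇒gap {h} = Equivalence.from (gaps-spec S h)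

  ¬Λ⇒positive : ∀ {h} → ¬ Λ S h → 0 < h
  ¬Λ⇒positive {zero}  ¬Λ0 = contradiction (zero∈ S) ¬Λ0
  ¬Λ⇒positive {suc h} _   = z<s

  ∈-nongapsUpTo⁻ : ∀ {s m} → s ∈ nongapsUpTo m → (0 < s × s ≤ m) × Λ S s
  ∈-nongapsUpTo⁻ {m = m} s∈ = map₁ ∈-oneTo⁻ (∈-filter⁻ (Λ? S) {xs = oneTo m} s∈)

  ∈-gapsUpTo⁻ : ∀ {h m} → h ∈ gapsUpTo m → (0 < h × h ≤ m) × ¬ Λ S h
  ∈-gapsUpTo⁻ {m = m} h∈ = map₁ ∈-oneTo⁻ (∈-filter⁻ (∁? (Λ? S)) {xs = oneTo m} h∈)

  ∈-gapsUpTo⁺ : ∀ {h m} → 0 < h → h ≤ m → ¬ Λ S h → h ∈ gapsUpTo m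
  ∈-gapsUpTo⁺ 0<h h≤m = ∈-filter⁺ (∁? (Λ? S)) (∈-oneTo⁺ 0<h h≤m)

  gapsUpTo-unique : ∀ n → Unique (gapsUpTo n)
  gapsUpTo-unique n = Unique.filter⁺ (∁? (Λ? S)) (oneTo-unique n)

  gapsUpTo⊆gaps : ∀ n → gapsUpTo n ⊆ gaps S
  gapsUpTo⊆gaps n h∈ = ¬Λ⇒gap (proj₂ (∈-gapsUpTo⁻ {m = n} h∈))

  gaps⊆gapsUpTo : ∀ {n} → (∀ {h} → h ∈ gaps S → h ≤ n) → gaps S ⊆ gapsUpTo n
  gaps⊆gapsUpTo gaps≤n h∈ =
    ∈-gapsUpTo⁺ (¬Λ⇒positive (gap⇒¬Λ h∈)) (gaps≤n h∈) (gap⇒¬Λ h∈)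

  length-gapsUpTo≡genus : ∀ {n} → (∀ {h} → h ∈ gaps S → h ≤ n) → length (gapsUpTo n) ≡ g
  length-gapsUpTo≡genus {n} gaps≤n = ≤-antisym
    (Unique-⊆⇒length-≤ (gapsUpTo-unique n) (gapsUpTo⊆gaps n))
    (Unique-⊆⇒length-≤ (gaps-unique S) (gaps⊆gapsUpTo gaps≤n))

  -- s ↦ h − s injects the nongaps up to m into the gaps up to m: s + (h − s) = h forbids
  -- h − s ∈ Λ, and h − s > m would put it strictly between m and h.
  nongaps≤gaps-belowFirstGap : ∀ {m h} → ¬ Λ S h → m < h → (∀ {j} → m < j → j < h → Λ S j) →
                               length (nongapsUpTo m) ≤ length (gapsUpTo m)
  nongaps≤gaps-belowFirstGap {m} {h} ¬Λh m<h Λ-between = begin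
    length (nongapsUpTo m)               ≡⟨ length-map (h ∸_) (nongapsUpTo m) ⟨
    length (map (h ∸_) (nongapsUpTo m)) ≤⟨ Unique-⊆⇒length-≤ reflection-unique reflection⊆gaps ⟩
    length (gapsUpTo m)                  ∎
    where
    open ≤-Reasoning

    nongap≤h : ∀ {s} → s ∈ nongapsUpTo m → s ≤ h
    nongap≤h s∈ = <⇒≤ (≤-<-trans (proj₂ (proj₁ (∈-nongapsUpTo⁻ s∈))) m<h)

    reflection-unique : Unique (map (h ∸_) (nongapsUpTo m))
    reflection-unique = Unique-map⁺-injectiveOn
      (λ s∈ t∈ → ∸-cancelˡ-≡ (nongap≤h s∈) (nongap≤h t∈))
      (Unique.filter⁺ (Λ? S) (oneTo-unique m))

    reflection-¬Λ : ∀ {s} → s ∈ nongapsUpTo m → ¬ Λ S (h ∸ s)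
    reflection-¬Λ s∈ Λh∸s =
      ¬Λh (subst (Λ S) (m+[n∸m]≡n (nongap≤h s∈)) (closed S (proj₂ (∈-nongapsUpTo⁻ {m = m} s∈)) Λh∸s))

    reflection∈gaps : ∀ {s} → s ∈ nongapsUpTo m → h ∸ s ∈ gapsUpTo m
    reflection∈gaps {s} s∈ with (0<s , s≤m) , _ ← ∈-nongapsUpTo⁻ s∈ =
      ∈-gapsUpTo⁺ (m<n⇒0<n∸m s<h) h∸s≤m (reflection-¬Λ s∈)
      where
      s<h : s < h
      s<h = ≤-<-trans s≤m m<h
      h∸s≤m : h ∸ s ≤ m
      h∸s≤m = ≮⇒≥ λ m<h∸s → reflection-¬Λ s∈ (Λ-between m<h∸s (∸-monoʳ-< 0<s (<⇒≤ s<h)))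

    reflection⊆gaps : map (h ∸_) (nongapsUpTo m) ⊆ gapsUpTo m
    reflection⊆gaps z∈ with s , s∈ , refl ← ∈-map⁻ (h ∸_) z∈ = reflection∈gaps s∈

  gap≤2genus : ∀ {h} → h ∈ gaps S → h ≤ g + g
  gap≤2genus {suc m} h∈ = begin
    suc m                                               ≡⟨ cong suc (length-nongapsUpTo+length-gapsUpTo m) ⟨
    suc (length (nongapsUpTo m) + length (gapsUpTo m)) ≤⟨ s≤s (+-monoˡ-≤ _ nongaps≤gaps) ⟩
    suc (length (gapsUpTo m) + length (gapsUpTo m))    ≤⟨ s≤s (+-monoʳ-≤ _ (n≤1+n _)) ⟩
    suc (length (gapsUpTo m)) + suc (length (gapsUpTo m)) ≤⟨ +-mono-≤ gapsUpTo<genus gapsUpTo<genus ⟩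
    g + g                                               ∎
    where
    open ≤-Reasoning
    nongaps≤gaps : length (nongapsUpTo m) ≤ length (gapsUpTo m)
    nongaps≤gaps = nongaps≤gaps-belowFirstGap (gap⇒¬Λ h∈) ≤-refl
                     (λ m<j j<1+m → contradiction (≤-pred j<1+m) (<⇒≱ m<j))
    gapsUpTo<genus : suc (length (gapsUpTo m)) ≤ g
    gapsUpTo<genus = Unique-⊆⇒length-≤
      (All.tabulate (λ z∈ → <⇒≢ (s≤s (proj₂ (proj₁ (∈-gapsUpTo⁻ z∈)))) ∘ sym)
        ∷ gapsUpTo-unique m)
      λ { (here refl) → h∈ ; (there z∈) → gapsUpTo⊆gaps m z∈ }
  gap≤2genus {zero} h∈ = contradiction (zero∈ S) (gap⇒¬Λ h∈)

  nongaps≤gaps : ∀ {m} → m ≤ g + g → length (nongapsUpTo m) ≤ length (gapsUpTo m)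
  nongaps≤gaps {m} m≤2g with any? (m <?_) (gaps S)
  ... | yes gap-above
    with h , h∈ , m<h ← find gap-above
    with k , ¬Λk , m<k , Λ-between ← firstFailureAbove (Λ? S) (gap⇒¬Λ h∈) m<h =
      nongaps≤gaps-belowFirstGap ¬Λk m<k Λ-between
  ... | no ¬gap-above = +-cancelʳ-≤ g _ _ (begin
    length (nongapsUpTo m) + g                      ≡⟨ cong (length (nongapsUpTo m) +_) gapsUpTo≡genus ⟨
    length (nongapsUpTo m) + length (gapsUpTo m)    ≡⟨ length-nongapsUpTo+length-gapsUpTo m ⟩
    m                                               ≤⟨ m≤2g ⟩
    g + g                                           ≡⟨ cong (_+ g) gapsUpTo≡genus ⟨
    length (gapsUpTo m) + g                         ∎)
    where
    open ≤-Reasoning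
    gapsUpTo≡genus : length (gapsUpTo m) ≡ g
    gapsUpTo≡genus = length-gapsUpTo≡genus (≮⇒≥ ∘ All.lookup (¬Any⇒All¬ (gaps S) ¬gap-above))

  length-gapsUpTo-2genus : length (gapsUpTo (g + g)) ≡ g
  length-gapsUpTo-2genus = length-gapsUpTo≡genus gap≤2genus

  length-nongapsUpTo-2genus : length (nongapsUpTo (g + g)) ≡ g
  length-nongapsUpTo-2genus = +-cancelʳ-≡ g _ _ (begin
    #nongaps + g                         ≡⟨ cong (#nongaps +_) length-gapsUpTo-2genus ⟨
    #nongaps + length (gapsUpTo (g + g)) ≡⟨ length-nongapsUpTo+length-gapsUpTo (g + g) ⟩
    g + g                                ∎)
    where
    open ≡-Reasoning
    #nongaps : ℕ
    #nongaps = length (nongapsUpTo (g + g))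

mainTheorem6 : (S : NumericalSemigroup) → IsDyckPath (genus S) (τ S)
mainTheorem6 S = reachesDiagonalCorner , staysAboveDiagonal
  where
  g : ℕ
  g = genus S

  τ≡prefix : τ S ≡ applyUpTo (e S ∘ suc) (g + g)
  τ≡prefix = map-oneTo (e S) (g + g)

  reachesDiagonalCorner : endpoint (0 , 0) (τ S) ≡ (g , g)
  reachesDiagonalCorner = trans (cong (endpoint (0 , 0)) τ≡prefix)
    (trans (endpoint-prefix S (g + g))
           (cong₂ _,_ (length-nongapsUpTo-2genus S) (length-gapsUpTo-2genus S)))

  staysAboveDiagonal : ∀ {a b} → (a , b) ∈ points (0 , 0) (τ S) → a ≤ b
  staysAboveDiagonal ab∈
    with j , j≤2g , ab≡ ← ∈-points⇒endpoint-prefix (e S ∘ suc) (g + g)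
                            (subst (λ path → _ ∈ points (0 , 0) path) τ≡prefix ab∈)
    with refl ← trans ab≡ (endpoint-prefix S j) = nongaps≤gaps S j≤2g
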